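{- Let $\mathbb{G}$ be a finite reflexive digraph which is S\l upecki and not strongly connected. Then the identity is alone in its connected component of $Hom(\mathbb{G},\mathbb{G})$.
   Context: All digraphs are finite and reflexive. A digraph is strongly connected if for any two vertices there are directed walks in both directions between them. A $k$-ary polymorphism is a homomorphism $\mathbb{G}^k\to\mathbb{G}$ from the product digraph; it is essentially unary if it equals $(x_1,\dots,x_k)\mapsto g(x_i)$ for some $i$ and homomorphism $g:\mathbb{G}\to\mathbb{G}$. $\mathbb{G}$ is S\l upecki if for every $k\geq2$ every surjective $k$-ary polymorphism is essentially unary. $Hom(\mathbb{G},\mathbb{G})$ has the endomorphisms as vertices, with an arc $(f,g)$ iff $(f(x),g(y))$ is an arc whenever $(x,y)$ is; connected components are those of the underlying undirected graph. -}

module Defs where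

open import Data.Nat using (ℕ; _≤_)
open import Data.Fin using (Fin)
open import Data.Product using (Σ; ∃; _×_; _,_)
open import Data.Sum using (_⊎_)
open import Relation.Nullary using (¬_; Dec)
open import Relation.Binary.PropositionalEquality using (_≡_)

record Digraph : Set₁ where
  field
    n      : ℕ
    E      : Fin n → Fin n → Set
    E-dec  : ∀ x y → Dec (E x y)
    E-refl : ∀ x → E x x

module _ (G : Digraph) where
  open Digraph G

  V : Set
  V = Fin n

  data Walk : V → V → Set where
    here : ∀ {x} → Walk x x
    step : ∀ {x y z} → E x y → Walk y z → Walk x z

  StronglyConnected : Set
  StronglyConnected = ∀ x y → Walk x y × Walk y x

  IsHom : (V → V) → Set
  IsHom g = ∀ x y → E x y → E (g x) (g y)

  -- k-ary polymorphism: homomorphism G^k → G (product digraph: arc iff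
  -- arc coordinatewise); tuples are functions Fin k → V
  IsPolymorphism : (k : ℕ) → ((Fin k → V) → V) → Set
  IsPolymorphism k f =
    ∀ (xs ys : Fin k → V) → (∀ i → E (xs i) (ys i)) → E (f xs) (f ys)

  IsSurjective : ∀ k → ((Fin k → V) → V) → Set
  IsSurjective k f = ∀ v → ∃ λ (xs : Fin k → V) → f xs ≡ v

  EssentiallyUnary : ∀ k → ((Fin k → V) → V) → Set
  EssentiallyUnary k f =
    Σ (Fin k) λ i → Σ (V → V) λ g → IsHom g × (∀ xs → f xs ≡ g (xs i))

  Slupecki : Set
  Slupecki = ∀ (k : ℕ) → 2 ≤ k → (f : (Fin k → V) → V) →
             IsPolymorphism k f → IsSurjective k f → EssentiallyUnary k f

  -- vertices of Hom(G,G)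
  record End : Set where
    constructor mkEnd
    field
      fun   : V → V
      isHom : IsHom fun

  idEnd : End
  idEnd = mkEnd (λ x → x) (λ x y e → e)

  -- arcs of Hom(G,G)
  HomArc : End → End → Set
  HomArc f g = ∀ x y → E x y → E (End.fun f x) (End.fun g y)

  data Connected : End → End → Set where
    here : ∀ {f} → Connected f f
    fwd  : ∀ {f g h} → HomArc f g → Connected g h → Connected f h
    bwd  : ∀ {f g h} → HomArc g f → Connected g h → Connected f h

-- Suppose a does not reach b, and let p, q be endomorphisms with an arc from q
-- to p in Hom(G,G), one of them surjective.  The binary operation
-- f(x, y) = p x if a reaches y, and q x otherwise, is a surjective
-- polymorphism, since the vertices reachable from a form an up-set.  By the
-- Słupecki property f depends on a single coordinate: not on y, as p or q is
-- surjective and a ≠ b, so on x, which forces p = q.  Along a path from the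
-- identity in Hom(G,G) every neighbour of an endomorphism equal to the
-- identity is thus the identity again.  Reachability is decided only up to
-- double negation, which is harmless because equality of vertices is
-- decidable.
module Submission where

open import Defs
open import Data.Fin using (Fin; zero; suc; _≟_)
open import Data.Fin.Properties using (sequence)
open import Data.Product using (∃; ∃₂; _,_)
open import Data.Sum using (_⊎_; inj₁; inj₂; [_,_])
open import Data.Nat using (s≤s; z≤n)
open import Data.Vec.Functional using ([]; _∷_)
open import Effect.Monad using (RawMonad)
open import Level using (0ℓ)
open import Relation.Nullary using (¬_; Dec; yes; no)
open import Relation.Nullary.Decidable using (decidable-stable; ¬¬-excluded-middle)
open import Relation.Nullary.Negation using (¬¬-Monad; contradiction)
open import Relation.Binary.PropositionalEquality
  using (_≡_; refl; sym; trans; subst; module ≡-Reasoning)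

open RawMonad (¬¬-Monad {0ℓ}) using (rawApplicative; pure; _>>=_)

¬¬-∀-Fin : ∀ {n} {P : Fin n → Set} → (∀ i → ¬ ¬ P i) → ¬ ¬ (∀ i → P i)
¬¬-∀-Fin = sequence rawApplicative

module _ (G : Digraph) where
  open Digraph G

  walk-snoc : ∀ {x y z} → Walk G x y → E y z → Walk G x z
  walk-snoc here         e = step e here
  walk-snoc (step e′ w) e = step e′ (walk-snoc w e)

  ¬¬-Walk-decidable : ∀ a → ¬ ¬ (∀ y → Dec (Walk G a y))
  ¬¬-Walk-decidable a = ¬¬-∀-Fin (λ y → ¬¬-excluded-middle)

  ¬StronglyConnected⇒¬¬unreachable :
    ¬ StronglyConnected G → ¬ ¬ (∃₂ λ a b → ¬ Walk G a b)
  ¬StronglyConnected⇒¬¬unreachable ¬sc ¬unreachable =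
    ¬¬walks (λ walks → ¬sc (λ x y → walks x y , walks y x))
    where
    ¬¬walks : ¬ ¬ (∀ a b → Walk G a b)
    ¬¬walks = ¬¬-∀-Fin (λ a → ¬¬-∀-Fin (λ b ¬w → ¬unreachable (a , b , ¬w)))

  Surjective : End G → Set
  Surjective p = ∀ v → ∃ λ u → End.fun p u ≡ v

  pointwise-identity-surjective : (f : End G) → (∀ x → End.fun f x ≡ x) → Surjective f
  pointwise-identity-surjective f f≡id v = v , f≡id v

  surjective-constant⇒trivial : (r : End G) → Surjective r → ∀ {c} →
    (∀ u → End.fun r u ≡ c) → ∀ x y → x ≡ y
  surjective-constant⇒trivial r onto r≡c x y with onto x | onto y
  ... | u , refl | w , refl = trans (r≡c u) (sym (r≡c w))

  module Switch (a : V G) (reach? : ∀ y → Dec (Walk G a y)) (p q : End G) where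
    open End p using () renaming (fun to p′)
    open End q using () renaming (fun to q′)

    switch : (Fin 2 → V G) → V G
    switch xs with reach? (xs (suc zero))
    ... | yes _ = p′ (xs zero)
    ... | no  _ = q′ (xs zero)

    switch-reached : ∀ {y} u → Walk G a y → switch (u ∷ y ∷ []) ≡ p′ u
    switch-reached {y} u a⇝y with reach? y
    ... | yes _    = refl
    ... | no  ¬a⇝y = contradiction a⇝y ¬a⇝y

    switch-unreached : ∀ {y} u → ¬ Walk G a y → switch (u ∷ y ∷ []) ≡ q′ u
    switch-unreached {y} u ¬a⇝y with reach? y
    ... | yes a⇝y = contradiction a⇝y ¬a⇝y
    ... | no  _   = refl

    switch-isPolymorphism : HomArc G q p → IsPolymorphism G 2 switch
    switch-isPolymorphism q→p xs ys es
      with reach? (xs (suc zero)) | reach? (ys (suc zero))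
    ... | yes _   | yes _    = End.isHom p _ _ (es zero)
    ... | yes a⇝x | no  ¬a⇝y = contradiction (walk-snoc a⇝x (es (suc zero))) ¬a⇝y
    ... | no  _   | yes _    = q→p _ _ (es zero)
    ... | no  _   | no  _    = End.isHom q _ _ (es zero)

    module _ {b : V G} (¬a⇝b : ¬ Walk G a b) where

      switch-surjective : Surjective p ⊎ Surjective q → IsSurjective G 2 switch
      switch-surjective (inj₁ p-onto) v with p-onto v
      ... | u , refl = u ∷ a ∷ [] , switch-reached u here
      switch-surjective (inj₂ q-onto) v with q-onto v
      ... | u , refl = u ∷ b ∷ [] , switch-unreached u ¬a⇝b

      switch-ignores-second : Surjective p ⊎ Surjective q →
        (h : V G → V G) → ¬ (∀ xs → switch xs ≡ h (xs (suc zero)))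
      switch-ignores-second onto h f≡h = ¬a⇝b (subst (Walk G a) a≡b here)
        where
        p-const : ∀ u → p′ u ≡ h a
        p-const u = trans (sym (switch-reached u here)) (f≡h (u ∷ a ∷ []))
        q-const : ∀ u → q′ u ≡ h b
        q-const u = trans (sym (switch-unreached u ¬a⇝b)) (f≡h (u ∷ b ∷ []))
        a≡b : a ≡ b
        a≡b = [ (λ p-onto → surjective-constant⇒trivial p p-onto p-const a b)
              , (λ q-onto → surjective-constant⇒trivial q q-onto q-const a b) ] onto

      switch-first⇒equal : (h : V G → V G) →
        (∀ xs → switch xs ≡ h (xs zero)) → ∀ u → p′ u ≡ q′ u
      switch-first⇒equal h f≡h u = begin
        p′ u               ≡⟨ sym (switch-reached u here) ⟩
        switch (u ∷ a ∷ []) ≡⟨ f≡h (u ∷ a ∷ []) ⟩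
        h u                ≡⟨ sym (f≡h (u ∷ b ∷ [])) ⟩
        switch (u ∷ b ∷ []) ≡⟨ switch-unreached u ¬a⇝b ⟩
        q′ u               ∎
        where open ≡-Reasoning

      switch-essentiallyUnary⇒equal : Surjective p ⊎ Surjective q →
        EssentiallyUnary G 2 switch → ∀ u → p′ u ≡ q′ u
      switch-essentiallyUnary⇒equal _    (zero     , h , _ , f≡h) =
        switch-first⇒equal h f≡h
      switch-essentiallyUnary⇒equal onto (suc zero , h , _ , f≡h) =
        contradiction f≡h (switch-ignores-second onto h)

  module _ (slupecki : Slupecki G) (¬sc : ¬ StronglyConnected G) where

    HomArc⇒equal : (p q : End G) → HomArc G q p → Surjective p ⊎ Surjective q →
      ∀ x → End.fun p x ≡ End.fun q x
    HomArc⇒equal p q q→p onto x = decidable-stable (End.fun p x ≟ End.fun q x) (do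
      (a , b , ¬a⇝b) ← ¬StronglyConnected⇒¬¬unreachable ¬sc
      reach? ← ¬¬-Walk-decidable a
      let open Switch a reach? p q
      pure (switch-essentiallyUnary⇒equal ¬a⇝b onto
        (slupecki 2 (s≤s (s≤s z≤n)) switch
          (switch-isPolymorphism q→p) (switch-surjective ¬a⇝b onto)) x))

    Connected-preserves-identity : ∀ {f g} → Connected G f g →
      (∀ x → End.fun f x ≡ x) → ∀ x → End.fun g x ≡ x
    Connected-preserves-identity here f≡id = f≡id
    Connected-preserves-identity {f} (fwd {g = h} f→h c) f≡id =
      Connected-preserves-identity c λ x → trans (h≡f x) (f≡id x)
      where
      h≡f : ∀ x → End.fun h x ≡ End.fun f x
      h≡f = HomArc⇒equal h f f→h (inj₂ (pointwise-identity-surjective f f≡id))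
    Connected-preserves-identity {f} (bwd {g = h} h→f c) f≡id =
      Connected-preserves-identity c λ x → trans (sym (f≡h x)) (f≡id x)
      where
      f≡h : ∀ x → End.fun f x ≡ End.fun h x
      f≡h = HomArc⇒equal f h h→f (inj₁ (pointwise-identity-surjective f f≡id))

lemma3p7 : (G : Digraph) → Slupecki G → ¬ StronglyConnected G →
    ∀ (g : End G) → Connected G (idEnd G) g → ∀ x → End.fun g x ≡ x
lemma3p7 G slupecki ¬sc g c =
  Connected-preserves-identity G slupecki ¬sc c (λ x → refl)
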